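{- Let $\lambda,\mu$ be strict partitions with $\mu\subseteq\lambda$, and let $\mathcal{C},\mathcal{C}'$ be configurations for $\lambda/\mu$ such that $\mathcal{C}'$ is obtained from $\mathcal{C}$ by exchanging the $0$'s of two rows $a$ and $b$, where in $\mathcal{C}$ row $a$ has type $(o,e)$ and row $b$ has type $(\emptyset,e)$, and in $\mathcal{C}'$ row $a$ has type $(\emptyset,o)$ and row $b$ has type $(o,o)$. Then $\kappa(\mathcal{C}')\le\kappa(\mathcal{C})$.
   Context: Let $S(\lambda)$ be the shifted diagram of $\lambda$ (row $i$ of the Young diagram shifted $i-1$ squares right). A configuration $\mathcal{C}$ of $0$'s for $\lambda/\mu$ assigns to each row $i$ an integer $z_i$ with $0\le z_i\le\lambda_i$ (the leftmost $z_i$ squares of row $i$ are filled with $0$, the other $\lambda_i-z_i$ squares are blank), such that the nonzero $z_i$'s, arranged in decreasing order, are exactly the parts of $\mu$. Exchanging the $0$'s of rows $a\ne b$ means replacing $(z_a,z_b)$ by $(z_b,z_a)$ (when this is again a configuration). Row types: $(e,e)$: $z_i>0$ even and $\lambda_i-z_i>0$ even; $(e,o)$: $z_i>0$ even, $\lambda_i-z_i$ odd; $(o,e)$: $z_i$ odd, $\lambda_i-z_i>0$ even; $(o,o)$: $z_i$ odd, $\lambda_i-z_i$ odd; $(\emptyset,e)$: $z_i=0$, $\lambda_i$ even; $(\emptyset,o)$: $z_i=0$, $\lambda_i$ odd; $(e,\emptyset)$: $z_i=\lambda_i$ even; $(o,\emptyset)$: $z_i=\lambda_i$ odd. Let $o_r$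 (resp. $e_r$) be the number of rows with $z_i=0$ and $\lambda_i$ odd (resp. even), and $o_s$ (resp. $e_s$) the number of rows with $z_i>0$ and $\lambda_i-z_i$ odd (resp. even and nonzero). Define $\kappa(\mathcal{C})=o_s+2e_s+\max\big(o_r,\ e_r+((e_r+o_r)\bmod 2)\big)$. -}

module Defs where

open import Data.Nat using (ℕ; zero; suc; _+_; _*_; _∸_; _≤_; _<_; _⊔_; _%_)
open import Data.Nat.Properties using (_≟_)
open import Data.Bool using (Bool; true; false; _∧_; not)
open import Data.Fin using (Fin; inject≤) renaming (_<_ to _<ᶠ_)
open import Data.Vec using (Vec; lookup; toList; zipWith)
open import Data.List using (List; filter; length)
open import Data.List.Relation.Binary.Permutation.Propositional using (_↭_)
open import Relation.Nullary using (¬_)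
open import Relation.Nullary.Decidable using (¬?)
open import Relation.Binary.PropositionalEquality using (_≡_)
open import Data.Product using (_×_)

Even : ℕ → Set
Even n = n % 2 ≡ 0

Odd : ℕ → Set
Odd n = n % 2 ≡ 1

StrictPartition : {k : ℕ} → Vec ℕ k → Set
StrictPartition {k} v =
  (∀ (i j : Fin k) → i <ᶠ j → lookup v j < lookup v i)
  × (∀ (i : Fin k) → 0 < lookup v i)

Contained : {m n : ℕ} → m ≤ n → Vec ℕ m → Vec ℕ n → Set
Contained {m} m≤n μ lam = ∀ (i : Fin m) → lookup μ i ≤ lookup lam (inject≤ i m≤n)

-- a configuration of 0's for λ/μ: z i = number of 0's in row i,
-- 0 ≤ z i ≤ λ i, and the nonzero z i's form (as a multiset, i.e. arranged in
-- decreasing order) exactly the parts of μ.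
IsConfiguration : {m n : ℕ} → Vec ℕ n → Vec ℕ m → Vec ℕ n → Set
IsConfiguration {m} {n} lam μ z =
  (∀ (i : Fin n) → lookup z i ≤ lookup lam i)
  × (filter (λ x → ¬? (x ≟ 0)) (toList z) ↭ toList μ)

isZero : ℕ → Bool
isZero zero = true
isZero (suc _) = false

isOdd : ℕ → Bool
isOdd n = not (isZero (n % 2))

isOr : ℕ → ℕ → Bool
isOr l z = isZero z ∧ isOdd l

isEr : ℕ → ℕ → Bool
isEr l z = isZero z ∧ not (isOdd l)

isOs : ℕ → ℕ → Bool
isOs l z = not (isZero z) ∧ isOdd (l ∸ z)

isEs : ℕ → ℕ → Bool
isEs l z = not (isZero z) ∧ (not (isOdd (l ∸ z)) ∧ not (isZero (l ∸ z)))

countRows : {n : ℕ} → (ℕ → ℕ → Bool) → Vec ℕ n → Vec ℕ n → ℕ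
countRows p lam z = length (filter (λ b → b Data.Bool.≟ true) (toList (zipWith p lam z)))

oᵣ eᵣ oₛ eₛ : {n : ℕ} → Vec ℕ n → Vec ℕ n → ℕ
oᵣ = countRows isOr
eᵣ = countRows isEr
oₛ = countRows isOs
eₛ = countRows isEs

κ : {n : ℕ} → Vec ℕ n → Vec ℕ n → ℕ
κ lam z = oₛ lam z + 2 * eₛ lam z + (oᵣ lam z ⊔ (eᵣ lam z + ((eᵣ lam z + oᵣ lam z) % 2)))

-- Exchanging the 0's of rows a and b only changes the contributions of those two rows to the four
-- counts: row a moves from eₛ to oᵣ and row b from eᵣ to oₛ. Thus oₛ and oᵣ grow by one while eₛ
-- and eᵣ drop by one; the loss of 2 in 2 eₛ pays for the gain of 1 in oₛ and for the growth by at
-- most 1 of the maximum, whose parity term (eᵣ + oᵣ) mod 2 is unchanged.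
module Submission where

open import Defs
open import Data.Nat using (ℕ; suc; _+_; _*_; _∸_; _⊔_; _%_; _≤_; _<_; s≤s)
open import Data.Nat.Properties
  using (+-identityʳ; +-comm; +-assoc; +-suc; +-monoʳ-≤; ≤-trans; ≤-reflexive; n≤1+n;
         m≤m⊔n; m≤n⇒m≤o⊔n; ⊔-lub; +-commutativeSemigroup)
open import Algebra.Properties.CommutativeSemigroup +-commutativeSemigroup using (xy∙z≈zy∙x)
open import Data.Nat.Tactic.RingSolver using (solve-∀)
open import Data.Bool using (Bool; true; false; if_then_else_)
open import Data.Fin using (Fin)
import Data.Fin as Fin
open import Data.Vec using (Vec; _∷_; lookup; _[_]≔_)
open import Data.Vec.Properties using (lookup∘update; lookup∘update′)
open import Relation.Binary.PropositionalEquality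
  using (_≡_; _≢_; refl; sym; trans; cong; subst; module ≡-Reasoning)

open ≡-Reasoning

bit : Bool → ℕ
bit b = if b then 1 else 0

countRows-∷ : ∀ (p : ℕ → ℕ → Bool) {n} l w (lam z : Vec ℕ n)
  → countRows p (l ∷ lam) (w ∷ z) ≡ bit (p l w) + countRows p lam z
countRows-∷ p l w lam z with p l w
... | true  = refl
... | false = refl

countRows-update : ∀ (p : ℕ → ℕ → Bool) {n} (lam z : Vec ℕ n) (i : Fin n) (v : ℕ)
  → countRows p lam (z [ i ]≔ v) + bit (p (lookup lam i) (lookup z i))
    ≡ countRows p lam z + bit (p (lookup lam i) v)
countRows-update p (l ∷ lam) (w ∷ z) Fin.zero v = begin
  countRows p (l ∷ lam) (v ∷ z) + bit (p l w)   ≡⟨ cong (_+ bit (p l w)) (countRows-∷ p l v lam z) ⟩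
  bit (p l v) + countRows p lam z + bit (p l w) ≡⟨ xy∙z≈zy∙x (bit (p l v)) _ _ ⟩
  bit (p l w) + countRows p lam z + bit (p l v) ≡⟨ cong (_+ bit (p l v)) (countRows-∷ p l w lam z) ⟨
  countRows p (l ∷ lam) (w ∷ z) + bit (p l v)   ∎
countRows-update p (l ∷ lam) (w ∷ z) (Fin.suc i) v = begin
  countRows p (l ∷ lam) (w ∷ z [ i ]≔ v) + old            ≡⟨ cong (_+ old) (countRows-∷ p l w lam _) ⟩
  bit (p l w) + countRows p lam (z [ i ]≔ v) + old        ≡⟨ +-assoc (bit (p l w)) _ old ⟩
  bit (p l w) + (countRows p lam (z [ i ]≔ v) + old)      ≡⟨ cong (bit (p l w) +_) (countRows-update p lam z i v) ⟩
  bit (p l w) + (countRows p lam z + new)                 ≡⟨ +-assoc (bit (p l w)) _ new ⟨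
  bit (p l w) + countRows p lam z + new                   ≡⟨ cong (_+ new) (countRows-∷ p l w lam z) ⟨
  countRows p (l ∷ lam) (w ∷ z) + new                     ∎
  where
  old = bit (p (lookup lam i) (lookup z i))
  new = bit (p (lookup lam i) v)

exchange : ∀ {n} → Vec ℕ n → Fin n → Fin n → Vec ℕ n
exchange z a b = (z [ a ]≔ lookup z b) [ b ]≔ lookup z a

lookup-exchange-first : ∀ {n} (z : Vec ℕ n) {a b : Fin n} → a ≢ b
  → lookup (exchange z a b) a ≡ lookup z b
lookup-exchange-first z {a} {b} a≢b =
  trans (lookup∘update′ a≢b (z [ a ]≔ lookup z b) (lookup z a)) (lookup∘update a z (lookup z b))

lookup-exchange-second : ∀ {n} (z : Vec ℕ n) (a b : Fin n)
  → lookup (exchange z a b) b ≡ lookup z a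
lookup-exchange-second z a b = lookup∘update b (z [ a ]≔ lookup z b) (lookup z a)

countRows-exchange : ∀ (p : ℕ → ℕ → Bool) {n} (lam z : Vec ℕ n) {a b : Fin n} → a ≢ b →
  let la = lookup lam a; lb = lookup lam b; z′ = exchange z a b in
  countRows p lam z′ + (bit (p la (lookup z a)) + bit (p lb (lookup z b)))
    ≡ countRows p lam z + (bit (p la (lookup z′ a)) + bit (p lb (lookup z′ b)))
countRows-exchange p lam z {a} {b} a≢b
  rewrite lookup-exchange-first z a≢b | lookup-exchange-second z a b = begin
    countRows p lam z′ + (bit (p la x) + bit (p lb y)) ≡⟨ cong (countRows p lam z′ +_) (+-comm (bit (p la x)) _) ⟩
    countRows p lam z′ + (bit (p lb y) + bit (p la x)) ≡⟨ +-assoc (countRows p lam z′) _ _ ⟨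
    countRows p lam z′ + bit (p lb y) + bit (p la x)   ≡⟨ cong (_+ bit (p la x)) second-row ⟩
    countRows p lam z₁ + bit (p lb x) + bit (p la x)   ≡⟨ xy∙z≈zy∙x (countRows p lam z₁) _ _ ⟩
    bit (p la x) + bit (p lb x) + countRows p lam z₁   ≡⟨ +-comm _ (countRows p lam z₁) ⟩
    countRows p lam z₁ + (bit (p la x) + bit (p lb x)) ≡⟨ +-assoc (countRows p lam z₁) _ _ ⟨
    countRows p lam z₁ + bit (p la x) + bit (p lb x)   ≡⟨ cong (_+ bit (p lb x)) (countRows-update p lam z a y) ⟩
    countRows p lam z + bit (p la y) + bit (p lb x)    ≡⟨ +-assoc (countRows p lam z) _ _ ⟩
    countRows p lam z + (bit (p la y) + bit (p lb x))  ∎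
  where
  la = lookup lam a
  lb = lookup lam b
  x = lookup z a
  y = lookup z b
  z₁ = z [ a ]≔ y
  z′ = exchange z a b
  second-row : countRows p lam z′ + bit (p lb y) ≡ countRows p lam z₁ + bit (p lb x)
  second-row = subst (λ w → countRows p lam z′ + bit (p lb w) ≡ countRows p lam z₁ + bit (p lb x))
    (lookup∘update′ (λ b≡a → a≢b (sym b≡a)) z y) (countRows-update p lam z₁ b x)

record RowIndicators : Set where
  constructor indicators
  field
    or? er? os? es? : Bool

rowIndicators : ℕ → ℕ → RowIndicators
rowIndicators l z = indicators (isOr l z) (isEr l z) (isOs l z) (isEs l z)

type-oe type-∅e type-∅o type-oo : RowIndicators
type-oe = indicators false false false true
type-∅e = indicators false true  false false
type-∅o = indicators true  false false false
type-oo = indicators false false true  false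

isOdd-odd : ∀ {n} → Odd n → isOdd n ≡ true
isOdd-odd odd rewrite odd = refl

isOdd-even : ∀ {n} → Even n → isOdd n ≡ false
isOdd-even even rewrite even = refl

isZero-odd : ∀ {n} → Odd n → isZero n ≡ false
isZero-odd {suc n} _ = refl

isZero-pos : ∀ {n} → 0 < n → isZero n ≡ false
isZero-pos {suc n} _ = refl

rowIndicators-oe : ∀ {l z} → Odd z → 0 < l ∸ z → Even (l ∸ z) → rowIndicators l z ≡ type-oe
rowIndicators-oe {l} {z} z-odd rest-pos rest-even
  rewrite isZero-odd {z} z-odd | isZero-pos rest-pos | isOdd-even {l ∸ z} rest-even = refl

rowIndicators-∅e : ∀ {l z} → z ≡ 0 → Even l → rowIndicators l z ≡ type-∅e
rowIndicators-∅e {l} refl l-even rewrite isOdd-even {l} l-even = refl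

rowIndicators-∅o : ∀ {l z} → z ≡ 0 → Odd l → rowIndicators l z ≡ type-∅o
rowIndicators-∅o {l} refl l-odd rewrite isOdd-odd {l} l-odd = refl

rowIndicators-oo : ∀ {l z} → Odd z → Odd (l ∸ z) → rowIndicators l z ≡ type-oo
rowIndicators-oo {l} {z} z-odd rest-odd
  rewrite isZero-odd {z} z-odd | isOdd-odd {l ∸ z} rest-odd = refl

countRows-exchange-indicators : ∀ (π : RowIndicators → Bool) {n} (lam z : Vec ℕ n) {a b : Fin n}
  {T₁ T₂ T₃ T₄ : RowIndicators} → a ≢ b →
  let la = lookup lam a; lb = lookup lam b; z′ = exchange z a b in
  rowIndicators la (lookup z a) ≡ T₁ → rowIndicators lb (lookup z b) ≡ T₂ →
  rowIndicators la (lookup z′ a) ≡ T₃ → rowIndicators lb (lookup z′ b) ≡ T₄ →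
  countRows (λ l w → π (rowIndicators l w)) lam z′ + (bit (π T₁) + bit (π T₂))
    ≡ countRows (λ l w → π (rowIndicators l w)) lam z + (bit (π T₃) + bit (π T₄))
countRows-exchange-indicators π lam z a≢b refl refl refl refl =
  countRows-exchange (λ l w → π (rowIndicators l w)) lam z a≢b

gains-row : ∀ {c′ c} → c′ + 0 ≡ c + 1 → c′ ≡ suc c
gains-row {c′} {c} eq = trans (sym (+-identityʳ c′)) (trans eq (+-comm c 1))

loses-row : ∀ {c′ c} → c′ + 1 ≡ c + 0 → c ≡ suc c′
loses-row {c′} {c} eq = trans (sym (+-identityʳ c)) (trans (sym eq) (+-comm c′ 1))

-- κ lam z is definitionally κ-counts (oₛ lam z) (eₛ lam z) (oᵣ lam z) (eᵣ lam z).
κ-counts : (os es or er : ℕ) → ℕ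
κ-counts os es or er = os + 2 * es + (or ⊔ (er + (er + or) % 2))

⊔-exchange : ∀ o e → suc o ⊔ (e + (e + suc o) % 2) ≤ suc (o ⊔ (suc e + (suc e + o) % 2))
⊔-exchange o e rewrite +-suc e o =
  ⊔-lub (s≤s (m≤m⊔n o _)) (≤-trans (n≤1+n _) (s≤s (m≤n⇒m≤o⊔n o (n≤1+n _))))

κ-counts-exchange : ∀ {os es or er os′ es′ or′ er′}
  → os′ ≡ suc os → es ≡ suc es′ → or′ ≡ suc or → er ≡ suc er′
  → κ-counts os′ es′ or′ er′ ≤ κ-counts os es or er
κ-counts-exchange {os} {_} {or} {_} {_} {es′} {_} {er′} refl refl refl refl =
  ≤-trans (+-monoʳ-≤ (suc (os + 2 * es′)) (⊔-exchange or er′))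
          (≤-reflexive (shift os es′ (or ⊔ (suc er′ + (suc er′ + or) % 2))))
  where
  shift : ∀ a b c → suc (a + 2 * b) + suc c ≡ a + 2 * suc b + c
  shift = solve-∀

κ-exchange : ∀ {n} (lam z : Vec ℕ n) {a b : Fin n} → a ≢ b →
  let la = lookup lam a; lb = lookup lam b; z′ = exchange z a b in
  rowIndicators la (lookup z a) ≡ type-oe → rowIndicators lb (lookup z b) ≡ type-∅e →
  rowIndicators la (lookup z′ a) ≡ type-∅o → rowIndicators lb (lookup z′ b) ≡ type-oo →
  κ lam z′ ≤ κ lam z
κ-exchange lam z {a} {b} a≢b a-oe b-∅e a-∅o b-oo = κ-counts-exchange
  (gains-row (change RowIndicators.os?))
  (loses-row (change RowIndicators.es?))
  (gains-row (change RowIndicators.or?))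
  (loses-row (change RowIndicators.er?))
  where
  change : ∀ π → let p = λ l w → π (rowIndicators l w) in
    countRows p lam (exchange z a b) + (bit (π type-oe) + bit (π type-∅e))
      ≡ countRows p lam z + (bit (π type-∅o) + bit (π type-oo))
  change π = countRows-exchange-indicators π lam z a≢b a-oe b-∅e a-∅o b-oo

mainTheorem7 : {m n : ℕ} (m≤n : m ≤ n) (λ′ : Vec ℕ n) (μ : Vec ℕ m)
    → StrictPartition λ′ → StrictPartition μ → Contained m≤n μ λ′
    → (z z′ : Vec ℕ n) → IsConfiguration λ′ μ z → IsConfiguration λ′ μ z′
    → (a b : Fin n) → a ≢ b
    → z′ ≡ ((z [ a ]≔ lookup z b) [ b ]≔ lookup z a)
    → Odd (lookup z a) → 0 < lookup λ′ a ∸ lookup z a → Even (lookup λ′ a ∸ lookup z a)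
    → lookup z b ≡ 0 → Even (lookup λ′ b)
    → lookup z′ a ≡ 0 → Odd (lookup λ′ a)
    → Odd (lookup z′ b) → Odd (lookup λ′ b ∸ lookup z′ b)
    → κ λ′ z′ ≤ κ λ′ z
mainTheorem7 _ lam _ _ _ _ z _ _ _ a b a≢b refl
  za-odd a-rest-pos a-rest-even zb≡0 lb-even z′a≡0 la-odd z′b-odd b-rest-odd =
  κ-exchange lam z a≢b
    (rowIndicators-oe {z = lookup z a} za-odd a-rest-pos a-rest-even)
    (rowIndicators-∅e zb≡0 lb-even)
    (rowIndicators-∅o z′a≡0 la-odd)
    (rowIndicators-oo {z = lookup (exchange z a b) b} z′b-odd b-rest-odd)
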